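{- Let $p$ be a prime, $\alpha$ a positive integer not divisible by $p$, and $e$ a positive integer. Let $S$ be the multiset consisting of the least nonnegative residues modulo $p^e$ of $\mathrm{u}(i)$ for all integers $i$ with $\alpha p^{e-1}<i\le\alpha p^e$. Then every positive integer less than $p^e$ that is not divisible by $p$ occurs exactly $\alpha$ times in $S$.
   Context: For a positive integer $n$, $\mathrm{u}(n)=n/p^{\nu(n)}$, where $\nu(n)$ is the exponent of $p$ in $n$. -}

module Defs where

open import Data.Nat using (ℕ; zero; suc; _+_; _*_; _∸_; _^_; _%_)
open import Data.Nat.Properties using (m^n≢0)
open import Data.Nat.Divisibility using (_∣?_; _∣_; quotient)
open import Data.Nat.Primality using (Prime; prime⇒nonZero)
open import Data.List using (List; applyUpTo; length; filter)
open import Relation.Nullary using (yes; no)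
open import Data.Nat using (_≟_)

-- Fuel-driven removal of factors p from n.  Stops when n = 0, when p ≤ 1,
-- or when p ∤ n.  With fuel ≥ n and p ≥ 2, n ≥ 1 the result is n / p^ν(n).
uFuel : ℕ → ℕ → ℕ → ℕ
uFuel zero          p n       = n
uFuel (suc f)       p zero    = zero
uFuel (suc f)       zero (suc n) = suc n
uFuel (suc f)       (suc zero) (suc n) = suc n
uFuel (suc f)       (suc (suc q)) (suc n) with suc (suc q) ∣? suc n
... | yes d = uFuel f (suc (suc q)) (quotient d)
... | no _  = suc n

u : ℕ → ℕ → ℕ
u p n = uFuel n p n

resPow : (p : ℕ) → Prime p → ℕ → ℕ → ℕ
resPow p pp e x = _%_ x (p ^ e) {{m^n≢0 p e {{prime⇒nonZero pp}}}}

S : (p : ℕ) → Prime p → ℕ → ℕ → List ℕ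
S p pp α e =
  applyUpTo (λ k → resPow p pp e (u p (α * p ^ (e ∸ 1) + suc k)))
            (α * p ^ e ∸ α * p ^ (e ∸ 1))

mult : ℕ → List ℕ → ℕ
mult r xs = length (filter (_≟ r) xs)

{-# OPTIONS --safe #-}
module Submission where

open import Defs
open import Data.Nat using (ℕ; _<_; _^_)
open import Data.Nat.Divisibility using (_∤_)
open import Data.Nat.Primality using (Prime)
open import Relation.Binary.PropositionalEquality using (_≡_)

open import Data.List using (List; _∷_; [_]; _++_; _∷ʳ_; applyUpTo; length; filter)
open import Data.List.Properties using (applyUpTo-∷ʳ; filter-++; filter-accept; filter-reject; length-++)
open import Data.Nat using (zero; suc; _+_; _*_; _∸_; _%_; _≤_; z≤n; s≤s; NonZero; NonTrivial; nonTrivial⇒nonZero; _≟_)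
open import Data.Nat.DivMod using ([m+n]%n≡m%n; m<n⇒m%n≡m; n%n≡0)
open import Data.Nat.Divisibility using (_∣_; _∣?_; quotient; quotient-<; ∣m+n∣m⇒∣n; ∣⇒≤; n∣m*n; m∣m*n; %-presˡ-∣)
open import Data.Nat.Primality using (prime⇒nonTrivial)
open import Data.Nat.Properties
open import Algebra.Properties.CommutativeSemigroup +-commutativeSemigroup using (interchange)
open import Function using (id; _∘_)
open import Relation.Binary.PropositionalEquality using (_≢_; refl; sym; trans; cong; cong₂; subst; module ≡-Reasoning)
open import Relation.Nullary using (yes; no; contradiction)

open ≡-Reasoning

-- Count the i ∈ (0, α pᵉ] with u(i) ≡ r (mod pᵉ).  Since u(j p) = u(j), the multiples
-- of p contribute the same count over (0, α pᵉ⁻¹].  For the other i we have u(i) = i,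
-- and as p ∤ r no multiple of p is ≡ r (mod pᵉ), so they contribute the number of
-- i ≤ α pᵉ with i ≡ r (mod pᵉ), namely α.  Removing (0, α pᵉ⁻¹] leaves α for S.

window : (ℕ → ℕ) → ℕ → ℕ → List ℕ
window f a n = applyUpTo (λ k → f (a + suc k)) n

applyUpTo-cong : ∀ {a} {A : Set a} {n} {g h : ℕ → A} → (∀ {k} → k < n → g k ≡ h k) →
                 applyUpTo g n ≡ applyUpTo h n
applyUpTo-cong {n = zero}  g≡h = refl
applyUpTo-cong {n = suc n} g≡h = cong₂ _∷_ (g≡h (s≤s z≤n)) (applyUpTo-cong (g≡h ∘ s≤s))

applyUpTo-++ : ∀ {a} {A : Set a} (g : ℕ → A) m n →
               applyUpTo g (m + n) ≡ applyUpTo g m ++ applyUpTo (g ∘ (m +_)) n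
applyUpTo-++ g zero    n = refl
applyUpTo-++ g (suc m) n = cong (g 0 ∷_) (applyUpTo-++ (g ∘ suc) m n)

window-cong : ∀ {n} f a f' a' → (∀ {k} → k < n → f (a + suc k) ≡ f' (a' + suc k)) →
              window f a n ≡ window f' a' n
window-cong f a f' a' = applyUpTo-cong

window-++ : ∀ f a m n → window f a (m + n) ≡ window f a m ++ window f (a + m) n
window-++ f a m n = trans (applyUpTo-++ _ m n)
  (cong (window f a m ++_) (applyUpTo-cong λ {k} _ →
    cong f (trans (cong (a +_) (sym (+-suc m k))) (sym (+-assoc a m (suc k))))))

window-suc : ∀ f a n → window f a (suc n) ≡ window f a n ∷ʳ f (a + suc n)
window-suc f a n = sym (applyUpTo-∷ʳ _ n)

module _ {r : ℕ} where

  mult-++ : ∀ xs ys → mult r (xs ++ ys) ≡ mult r xs + mult r ys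
  mult-++ xs ys = trans (cong length (filter-++ (_≟ r) xs ys)) (length-++ (filter (_≟ r) xs))

  mult-[r] : mult r [ r ] ≡ 1
  mult-[r] = cong length (filter-accept (_≟ r) refl)

  mult-[x]-≢ : ∀ {x} → x ≢ r → mult r [ x ] ≡ 0
  mult-[x]-≢ x≢r = cong length (filter-reject (_≟ r) x≢r)

  mult-window-+ : ∀ f a m n →
    mult r (window f a (m + n)) ≡ mult r (window f a m) + mult r (window f (a + m) n)
  mult-window-+ f a m n = trans (cong (mult r) (window-++ f a m n)) (mult-++ (window f a m) _)

  mult-window-suc : ∀ f a n →
    mult r (window f a (suc n)) ≡ mult r (window f a n) + mult r [ f (a + suc n) ]
  mult-window-suc f a n = trans (cong (mult r) (window-suc f a n)) (mult-++ (window f a n) _)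

  mult-window-id-< : ∀ n → n < r → mult r (window id 0 n) ≡ 0
  mult-window-id-< zero    _   = refl
  mult-window-id-< (suc n) n<r = begin
    mult r (window id 0 (suc n))              ≡⟨ mult-window-suc id 0 n ⟩
    mult r (window id 0 n) + mult r [ suc n ]
      ≡⟨ cong₂ _+_ (mult-window-id-< n (<-trans (n<1+n n) n<r)) (mult-[x]-≢ (<⇒≢ n<r)) ⟩
    0                                         ∎

  mult-window-id-≤ : ∀ n → 0 < r → r ≤ n → mult r (window id 0 n) ≡ 1
  mult-window-id-≤ zero    0<r r≤0 = contradiction r≤0 (<⇒≱ 0<r)
  mult-window-id-≤ (suc n) 0<r r≤1+n with r ≟ suc n
  ... | yes refl = begin
    mult r (window id 0 (suc n))          ≡⟨ mult-window-suc id 0 n ⟩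
    mult r (window id 0 n) + mult r [ r ] ≡⟨ cong₂ _+_ (mult-window-id-< n ≤-refl) mult-[r] ⟩
    1                                     ∎
  ... | no r≢1+n = begin
    mult r (window id 0 (suc n))              ≡⟨ mult-window-suc id 0 n ⟩
    mult r (window id 0 n) + mult r [ suc n ]
      ≡⟨ cong₂ _+_ (mult-window-id-≤ n 0<r (m<1+n⇒m≤n (≤∧≢⇒< r≤1+n r≢1+n)))
                   (mult-[x]-≢ (r≢1+n ∘ sym)) ⟩
    1                                         ∎

  mult-window-periodic : ∀ {f m} → (∀ i → f (i + m) ≡ f i) →
    ∀ k → mult r (window f 0 (k * m)) ≡ k * mult r (window f 0 m)
  mult-window-periodic         f-periodic zero    = refl
  mult-window-periodic {f} {m} f-periodic (suc k) = begin
    mult r (window f 0 (m + k * m))                      ≡⟨ mult-window-+ f 0 m (k * m) ⟩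
    mult r (window f 0 m) + mult r (window f m (k * m))  ≡⟨ cong (λ xs → mult r (window f 0 m) + mult r xs) shift ⟩
    mult r (window f 0 m) + mult r (window f 0 (k * m))  ≡⟨ cong (mult r (window f 0 m) +_) (mult-window-periodic f-periodic k) ⟩
    mult r (window f 0 m) + k * mult r (window f 0 m)    ∎
    where
    shift : window f m (k * m) ≡ window f 0 (k * m)
    shift = window-cong f m f 0 λ {t} _ → trans (cong f (+-comm m (suc t))) (f-periodic (suc t))

  mult-window-% : ∀ m .{{_ : NonZero m}} → 0 < r → r < m →
    ∀ k → mult r (window (_% m) 0 (k * m)) ≡ k
  mult-window-% m 0<r r<m k = begin
    mult r (window (_% m) 0 (k * m))  ≡⟨ mult-window-periodic (λ i → [m+n]%n≡m%n i m) k ⟩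
    k * mult r (window (_% m) 0 m)    ≡⟨ cong (k *_) (one-period m refl) ⟩
    k * 1                             ≡⟨ *-identityʳ k ⟩
    k                                 ∎
    where
    one-period : ∀ n → n ≡ m → mult r (window (_% m) 0 n) ≡ 1
    one-period zero    refl = contradiction r<m λ ()
    one-period (suc n) refl = begin
      mult r (window (_% m) 0 (suc n))                 ≡⟨ mult-window-suc (_% m) 0 n ⟩
      mult r (window (_% m) 0 n) + mult r [ m % m ]
        ≡⟨ cong₂ (λ xs x → mult r xs + mult r [ x ]) below-m (n%n≡0 m) ⟩
      mult r (window id 0 n) + mult r [ 0 ]
        ≡⟨ cong₂ _+_ (mult-window-id-≤ n 0<r (m<1+n⇒m≤n r<m)) (mult-[x]-≢ (<⇒≢ 0<r)) ⟩
      1                                                ∎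
      where
      below-m : window (_% m) 0 n ≡ window id 0 n
      below-m = window-cong (_% m) 0 id 0 λ t<n → m<n⇒m%n≡m (s≤s t<n)

∤-k*p+offset : ∀ {p t} .{{_ : NonZero p}} k → suc t < p → p ∤ k * p + suc t
∤-k*p+offset k 1+t<p p∣k*p+1+t = <⇒≱ 1+t<p (∣⇒≤ (∣m+n∣m⇒∣n p∣k*p+1+t (n∣m*n k)))

mult-window-blocks : ∀ {r} p .{{_ : NonZero p}} {g h : ℕ → ℕ} →
  (∀ j → g (suc j * p) ≡ g (suc j)) →
  (∀ i → p ∤ i → g i ≡ h i) →
  (∀ j → h (suc j * p) ≢ r) →
  ∀ a → mult r (window g 0 (a * p)) ≡ mult r (window g 0 a) + mult r (window h 0 (a * p))
mult-window-blocks {r} p@(suc p-1) {g} {h} g-mul g≡h h-mul≢r = go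
  where
  inner : ∀ a → window g (a * p) p-1 ≡ window h (a * p) p-1
  inner a = window-cong g (a * p) h (a * p) λ t<p-1 → g≡h _ (∤-k*p+offset a (s≤s t<p-1))

  -- The block (a p, a p + p] consists of p - 1 non-multiples, where g and h agree,
  -- and of (a + 1) p, which counts as g (a + 1) on the left and never on the right.
  go : ∀ a → mult r (window g 0 (a * p)) ≡ mult r (window g 0 a) + mult r (window h 0 (a * p))
  go zero    = refl
  go (suc a) = begin
    mult r (window g 0 (p + a * p))
      ≡⟨ cong (mult r ∘ window g 0) (+-comm p (a * p)) ⟩
    mult r (window g 0 (a * p + p))
      ≡⟨ mult-window-+ g 0 (a * p) p ⟩
    mult r (window g 0 (a * p)) + mult r (window g (a * p) p)
      ≡⟨ cong₂ _+_ (go a) (mult-window-suc g (a * p) p-1) ⟩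
    (G + H) + (mult r (window g (a * p) p-1) + mult r [ g (a * p + p) ])
      ≡⟨ cong₂ (λ xs x → (G + H) + (mult r xs + mult r [ x ])) (inner a) last-g ⟩
    (G + H) + (W + mult r [ g (suc a) ])
      ≡⟨ cong ((G + H) +_) (+-comm W _) ⟩
    (G + H) + (mult r [ g (suc a) ] + W)
      ≡⟨ interchange G H _ W ⟩
    (G + mult r [ g (suc a) ]) + (H + W)
      ≡⟨ cong₂ _+_ (sym (mult-window-suc g 0 a)) (cong (H +_) (sym block-h)) ⟩
    mult r (window g 0 (suc a)) + (H + mult r (window h (a * p) p))
      ≡⟨ cong (mult r (window g 0 (suc a)) +_) (sym (mult-window-+ h 0 (a * p) p)) ⟩
    mult r (window g 0 (suc a)) + mult r (window h 0 (a * p + p))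
      ≡⟨ cong (λ n → mult r (window g 0 (suc a)) + mult r (window h 0 n)) (+-comm (a * p) p) ⟩
    mult r (window g 0 (suc a)) + mult r (window h 0 (p + a * p)) ∎
    where
    G H W : ℕ
    G = mult r (window g 0 a)
    H = mult r (window h 0 (a * p))
    W = mult r (window h (a * p) p-1)
    last-g : g (a * p + p) ≡ g (suc a)
    last-g = trans (cong g (+-comm (a * p) p)) (g-mul a)
    block-h : mult r (window h (a * p) p) ≡ W
    block-h = begin
      mult r (window h (a * p) p)                        ≡⟨ mult-window-suc h (a * p) p-1 ⟩
      W + mult r [ h (a * p + p) ]
        ≡⟨ cong (W +_) (mult-[x]-≢ (h-mul≢r a ∘ trans (cong h (+-comm p (a * p))))) ⟩
      W + 0                                              ≡⟨ +-identityʳ W ⟩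
      W                                                  ∎

uFuel-stable : ∀ p .{{_ : NonTrivial p}} {f f'} n → n ≤ f → n ≤ f' → uFuel f p n ≡ uFuel f' p n
uFuel-stable (suc (suc _)) {zero}  {zero}  zero _ _ = refl
uFuel-stable (suc (suc _)) {zero}  {suc _} zero _ _ = refl
uFuel-stable (suc (suc _)) {suc _} {zero}  zero _ _ = refl
uFuel-stable (suc (suc _)) {suc _} {suc _} zero _ _ = refl
uFuel-stable p@(suc (suc q)) (suc n) (s≤s n≤f) (s≤s n≤f') with p ∣? suc n
... | yes p∣1+n = uFuel-stable p (quotient p∣1+n) (≤-trans q≤n n≤f) (≤-trans q≤n n≤f')
  where
  q≤n : quotient p∣1+n ≤ n
  q≤n = m<1+n⇒m≤n (quotient-< p∣1+n)
... | no _      = refl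

p∤n⇒u[n]≡n : ∀ p n → p ∤ n → u p n ≡ n
p∤n⇒u[n]≡n p zero p∤0 = refl
p∤n⇒u[n]≡n zero (suc n) _ = refl
p∤n⇒u[n]≡n (suc zero) (suc n) _ = refl
p∤n⇒u[n]≡n p@(suc (suc q)) (suc n) p∤1+n with p ∣? suc n
... | yes p∣1+n = contradiction p∣1+n p∤1+n
... | no _      = refl

u[n*p]≡u[n] : ∀ p .{{_ : NonTrivial p}} n → u p (n * p) ≡ u p n
u[n*p]≡u[n] p zero = refl
u[n*p]≡u[n] p@(suc (suc q)) (suc n) with p ∣? suc n * p
... | yes p∣n*p = trans (cong (uFuel _ p) quotient≡1+n)
                        (uFuel-stable p (suc n) (s≤s (m≤n⇒m≤o+n q (m≤m*n n p))) ≤-refl)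
  where
  quotient≡1+n : quotient p∣n*p ≡ suc n
  quotient≡1+n = *-cancelʳ-≡ (quotient p∣n*p) (suc n) p (sym (_∣_.equality p∣n*p))
... | no p∤n*p  = contradiction (n∣m*n (suc n)) p∤n*p

∣m∣n∤o⇒n%m≢o : ∀ {d m n o} .{{_ : NonZero m}} → d ∣ m → d ∣ n → d ∤ o → n % m ≢ o
∣m∣n∤o⇒n%m≢o d∣m d∣n d∤o n%m≡o = d∤o (subst (_ ∣_) n%m≡o (%-presˡ-∣ d∣n d∣m))

lemma2p1 : (p : ℕ) (pp : Prime p) (α e : ℕ) →
    0 < α → p ∤ α → 0 < e →
    (r : ℕ) → 0 < r → r < p ^ e → p ∤ r →
    mult r (S p pp α e) ≡ α
lemma2p1 p pp α (suc e) _ _ _ r 0<r r<m p∤r = +-cancelˡ-≡ G _ _ (begin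
  G + mult r (S p pp α (suc e))                       ≡⟨ mult-window-+ g 0 A (B ∸ A) ⟨
  mult r (window g 0 (A + (B ∸ A)))                   ≡⟨ cong (mult r ∘ window g 0) (trans (m+[n∸m]≡n A≤B) B≡A*p) ⟩
  mult r (window g 0 (A * p))                         ≡⟨ mult-window-blocks p g-mul g≡h h-mul≢r A ⟩
  G + mult r (window h 0 (A * p))                     ≡⟨ cong (λ n → G + mult r (window h 0 n)) B≡A*p ⟨
  G + mult r (window h 0 B)                           ≡⟨ cong (G +_) (mult-window-% m 0<r r<m α) ⟩
  G + α                                               ∎)
  where
  instance
    p-nonTrivial : NonTrivial p
    p-nonTrivial = prime⇒nonTrivial pp
    p-nonZero : NonZero p
    p-nonZero = nonTrivial⇒nonZero p
    m-nonZero : NonZero (p ^ suc e)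
    m-nonZero = m^n≢0 p (suc e)
  m A B : ℕ
  m = p ^ suc e
  A = α * p ^ e
  B = α * m
  g h : ℕ → ℕ
  g i = u p i % m
  h i = i % m
  G : ℕ
  G = mult r (window g 0 A)
  B≡A*p : B ≡ A * p
  B≡A*p = trans (cong (α *_) (*-comm p (p ^ e))) (sym (*-assoc α (p ^ e) p))
  A≤B : A ≤ B
  A≤B = subst (A ≤_) (sym B≡A*p) (m≤m*n A p)
  g-mul : ∀ j → g (suc j * p) ≡ g (suc j)
  g-mul j = cong (_% m) (u[n*p]≡u[n] p (suc j))
  g≡h : ∀ i → p ∤ i → g i ≡ h i
  g≡h i p∤i = cong (_% m) (p∤n⇒u[n]≡n p i p∤i)
  h-mul≢r : ∀ j → h (suc j * p) ≢ r
  h-mul≢r j = ∣m∣n∤o⇒n%m≢o (m∣m*n (p ^ e)) (n∣m*n (suc j)) p∤r
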